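{- Let $n\ge4$. Then $\Theta_n(0)=\Theta_n(4)=n$ and $\Theta_n(1)=\Theta_n(2)=\Theta_n(3)=n-1$.
   Context: All graphs are finite, simple and undirected. A clique cover of $G=(V,E)$ is a family of vertex sets, each inducing a clique, whose union is $V$ and such that every edge lies in some member. $\theta(G)$ is the minimum size of a clique cover of $G$. For $0\le m\le\binom n2$, $\Theta_n(m)$ is the maximum of $\theta(G)$ over all graphs $G$ with $n$ vertices and $m$ edges. -}

module Defs where

open import Data.Nat using (ℕ; _≤_; _<ᵇ_)
open import Data.Bool using (Bool; true; false; _∧_; if_then_else_)
open import Data.Fin using (Fin; toℕ)
open import Data.Fin.Subset using (Subset; _∈_)
open import Data.List using (List; length; map; allFin)
open import Data.Nat.ListAction using (sum)
open import Data.List.Relation.Unary.All using (All)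
open import Data.List.Relation.Unary.Any using (Any)
open import Data.Product using (Σ; _×_)
open import Relation.Binary.PropositionalEquality using (_≡_; _≢_)

record Graph (n : ℕ) : Set where
  field
    adj    : Fin n → Fin n → Bool
    sym    : ∀ i j → adj i j ≡ adj j i
    irrefl : ∀ i → adj i i ≡ false
open Graph public

edgeCount : ∀ {n} → Graph n → ℕ
edgeCount {n} G =
  sum (map (λ i → sum (map (λ j → if (toℕ i <ᵇ toℕ j) ∧ adj G i j then 1 else 0)
                           (allFin n)))
           (allFin n))

IsClique : ∀ {n} → Graph n → Subset n → Set
IsClique G S = ∀ i j → i ∈ S → j ∈ S → i ≢ j → adj G i j ≡ true

IsCliqueCover : ∀ {n} → Graph n → List (Subset n) → Set
IsCliqueCover {n} G C =
  All (IsClique G) C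
  × (∀ (v : Fin n) → Any (λ S → v ∈ S) C)
  × (∀ (i j : Fin n) → adj G i j ≡ true → Any (λ S → i ∈ S × j ∈ S) C)

HasCliqueCoverOfSize : ∀ {n} → Graph n → ℕ → Set
HasCliqueCoverOfSize {n} G k = Σ (List (Subset n)) (λ C → length C ≡ k × IsCliqueCover G C)

ThetaIs : ∀ {n} → Graph n → ℕ → Set
ThetaIs G k = HasCliqueCoverOfSize G k × (∀ k′ → HasCliqueCoverOfSize G k′ → k ≤ k′)

BigThetaIs : ℕ → ℕ → ℕ → Set
BigThetaIs n m k =
  Σ (Graph n) (λ G → edgeCount G ≡ m × ThetaIs G k)
  × (∀ (G : Graph n) (k′ : ℕ) → edgeCount G ≡ m → ThetaIs G k′ → k′ ≤ k)

-- Covering every edge by its own clique and every isolated vertex by a singleton gives θ(G) ≤ m + n − s,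
-- where s is the number of non-isolated vertices. One edge touches two vertices, two edges at least three and
-- four edges at least four; three edges touch four vertices unless they form a triangle, which a single clique
-- covers. Conversely, in the edgeless graph, in the stars K₁,₁, K₁,₂, K₁,₃ and in the 4-cycle, each padded
-- with isolated vertices, there are n resp. n − 1 vertices and edges no two of which lie in a common clique.

module Submission where

open import Defs hiding (sym)
open import Data.Nat using (ℕ; zero; suc; _+_; _∸_; _≤_; _<ᵇ_; z≤n; s≤s)
import Data.Nat.Properties as ℕ
open import Algebra.Properties.CommutativeSemigroup ℕ.+-commutativeSemigroup using (xy∙z≈xz∙y)
open import Data.Bool using (Bool; true; false; _∧_; _∨_; if_then_else_)
open import Data.Bool.Properties using (T-∧; T-≡; ∧-zeroʳ; ∨-comm)
open import Data.Fin using (Fin; zero; suc; toℕ; _<_; _≟_; _↑ˡ_; _↑ʳ_)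
import Data.Fin.Properties as Fin
open import Data.Fin.Subset using (Subset; ⁅_⁆; _∪_) renaming (_∈_ to _∈ₛ_; ⊥ to ∅)
open import Data.Fin.Subset.Properties using (x∈⁅x⁆; x∈⁅y⁆⇒x≡y; x∈p∪q⁻; x∈p∪q⁺; ∉⊥)
open import Data.List using (List; []; _∷_; _++_; length; map; replicate; allFin; tabulate; filterᵇ; cartesianProduct; lookup)
open import Data.List.Properties using (length-++; length-map; length-replicate; length-tabulate; filter-++; map-tabulate; map-cong)
open import Data.Nat.ListAction using (sum)
open import Data.Vec as Vec using (Vec)
open import Data.List.Relation.Unary.All as All using (All; []; _∷_; all?)
open import Data.List.Relation.Unary.All.Properties using (¬Any⇒All¬; ¬All⇒Any¬; replicate⁺)
import Data.List.Relation.Unary.All.Properties as All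
open import Data.List.Relation.Unary.Any as Any using (Any; here; there; index; any?)
import Data.List.Relation.Unary.Any.Properties as Any
open import Data.List.Relation.Unary.AllPairs using (AllPairs; []; _∷_)
open import Data.List.Relation.Unary.Unique.Propositional using (Unique)
import Data.List.Relation.Unary.Unique.Propositional.Properties as Unique
open import Data.List.Membership.Propositional using (_∈_; _∉_; find)
open import Data.List.Membership.Propositional.Properties using (∈-filter⁺; ∈-filter⁻; ∈-cartesianProduct⁺; ∈-allFin; ∈-++⁺ˡ)
open import Data.Product using (Σ-syntax; ∃-syntax; _×_; _,_; proj₁; proj₂)
import Data.Product
open import Data.Sum using (_⊎_; inj₁; inj₂)
import Data.Sum
open import Data.Empty using (⊥; ⊥-elim)
open import Relation.Nullary using (yes; no)
open import Relation.Nullary.Decidable using (T?)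
open import Relation.Binary.Definitions using (tri<; tri≈; tri>)
open import Relation.Binary.PropositionalEquality using (_≡_; _≢_; refl; sym; trans; cong; cong₂; subst; module ≡-Reasoning)
open import Function using (_∘_; Equivalence)

private variable
  n m j k b : ℕ

fromList : List (Fin n) → Subset n
fromList []       = ∅
fromList (x ∷ xs) = ⁅ x ⁆ ∪ fromList xs

∈-fromList⁺ : {x : Fin n} (xs : List (Fin n)) → x ∈ xs → x ∈ₛ fromList xs
∈-fromList⁺ {x = x} _ (here refl)  = x∈p∪q⁺ (inj₁ (x∈⁅x⁆ x))
∈-fromList⁺ (_ ∷ xs) (there x∈xs)  = x∈p∪q⁺ (inj₂ (∈-fromList⁺ xs x∈xs))

∈-fromList⁻ : {x : Fin n} (xs : List (Fin n)) → x ∈ₛ fromList xs → x ∈ xs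
∈-fromList⁻ []       x∈ = ⊥-elim (∉⊥ x∈)
∈-fromList⁻ (y ∷ xs) x∈ with x∈p∪q⁻ ⁅ y ⁆ (fromList xs) x∈
... | inj₁ x∈⁅y⁆ = here (x∈⁅y⁆⇒x≡y y x∈⁅y⁆)
... | inj₂ x∈xs  = there (∈-fromList⁻ xs x∈xs)

module _ (G : Graph n) where

  adj-sym : {x y : Fin n} → adj G x y ≡ true → adj G y x ≡ true
  adj-sym {x} {y} xy = trans (Graph.sym G y x) xy

  ⁅⁆-clique : (v : Fin n) → IsClique G ⁅ v ⁆
  ⁅⁆-clique v x y x∈ y∈ x≢y = ⊥-elim (x≢y (trans (x∈⁅y⁆⇒x≡y v x∈) (sym (x∈⁅y⁆⇒x≡y v y∈))))

  fromList-clique : {xs : List (Fin n)} → AllPairs (λ x y → adj G x y ≡ true) xs → IsClique G (fromList xs)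
  fromList-clique {xs} pairwise x y x∈ y∈ = adjacent pairwise (∈-fromList⁻ xs x∈) (∈-fromList⁻ xs y∈)
    where
    adjacent : ∀ {xs} → AllPairs (λ x y → adj G x y ≡ true) xs → x ∈ xs → y ∈ xs → x ≢ y → adj G x y ≡ true
    adjacent (_  ∷ _)  (here refl) (here refl) x≢y = ⊥-elim (x≢y refl)
    adjacent (xy ∷ _)  (here refl) (there y∈)  _   = All.lookup xy y∈
    adjacent (yx ∷ _)  (there x∈)  (here refl) _   = adj-sym (All.lookup yx x∈)
    adjacent (_  ∷ ps) (there x∈)  (there y∈)  x≢y = adjacent ps x∈ y∈ x≢y

  clique-nonadjacent : {S : Subset n} {x y : Fin n} → IsClique G S → x ∈ₛ S → y ∈ₛ S → x ≢ y → adj G x y ≡ false → ⊥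
  clique-nonadjacent clique x∈ y∈ x≢y nonadjacent with trans (sym (clique _ _ x∈ y∈ x≢y)) nonadjacent
  ... | ()

length-filterᵇ-map : {A B : Set} (p : B → Bool) (f : A → B) (xs : List A) →
  length (filterᵇ p (map f xs)) ≡ sum (map (λ x → if p (f x) then 1 else 0) xs)
length-filterᵇ-map p f []       = refl
length-filterᵇ-map p f (x ∷ xs) with p (f x)
... | true  = cong suc (length-filterᵇ-map p f xs)
... | false = length-filterᵇ-map p f xs

length-filterᵇ-cartesianProduct : {A B : Set} (p : A × B → Bool) (xs : List A) (ys : List B) →
  length (filterᵇ p (cartesianProduct xs ys))
    ≡ sum (map (λ x → sum (map (λ y → if p (x , y) then 1 else 0) ys)) xs)
length-filterᵇ-cartesianProduct p []       ys = refl
length-filterᵇ-cartesianProduct p (x ∷ xs) ys = begin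
  length (filterᵇ p (map (x ,_) ys ++ cartesianProduct xs ys))
    ≡⟨ cong length (filter-++ (T? ∘ p) (map (x ,_) ys) (cartesianProduct xs ys)) ⟩
  length (filterᵇ p (map (x ,_) ys) ++ filterᵇ p (cartesianProduct xs ys))
    ≡⟨ length-++ (filterᵇ p (map (x ,_) ys)) ⟩
  length (filterᵇ p (map (x ,_) ys)) + length (filterᵇ p (cartesianProduct xs ys))
    ≡⟨ cong₂ _+_ (length-filterᵇ-map p (x ,_) ys) (length-filterᵇ-cartesianProduct p xs ys) ⟩
  _ ∎
  where open ≡-Reasoning

isEdge : Graph n → Fin n × Fin n → Bool
isEdge G (x , y) = (toℕ x <ᵇ toℕ y) ∧ adj G x y

edges : Graph n → List (Fin n × Fin n)
edges {n} G = filterᵇ (isEdge G) (cartesianProduct (allFin n) (allFin n))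

length-edges : (G : Graph n) → length (edges G) ≡ edgeCount G
length-edges {n} G = length-filterᵇ-cartesianProduct (isEdge G) (allFin n) (allFin n)

record EdgeList (G : Graph n) (E : List (Fin n × Fin n)) : Set where
  field
    unique   : Unique E
    sound    : ∀ {x y} → (x , y) ∈ E → x < y × adj G x y ≡ true
    complete : ∀ {x y} → x < y → adj G x y ≡ true → (x , y) ∈ E

edges-edgeList : (G : Graph n) → EdgeList G (edges G)
edges-edgeList {n} G = record
  { unique   = Unique.filter⁺ (T? ∘ isEdge G) (Unique.cartesianProduct⁺ (Unique.allFin⁺ n) (Unique.allFin⁺ n))
  ; sound    = λ e∈ → let x<y , xy = Equivalence.to T-∧ (proj₂ (∈-filter⁻ (T? ∘ isEdge G) {xs = pairs} e∈))
                      in ℕ.<ᵇ⇒< _ _ x<y , Equivalence.to T-≡ xy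
  ; complete = λ x<y xy → ∈-filter⁺ (T? ∘ isEdge G) (∈-cartesianProduct⁺ (∈-allFin _) (∈-allFin _))
                            (Equivalence.from T-∧ (ℕ.<⇒<ᵇ x<y , Equivalence.from T-≡ xy))
  }
  where
  pairs : List (Fin n × Fin n)
  pairs = cartesianProduct (allFin n) (allFin n)

vecOfLength : {A : Set} (xs : List A) → length xs ≡ m → Σ[ v ∈ Vec A m ] Vec.toList v ≡ xs
vecOfLength []       refl = Vec.[] , refl
vecOfLength (x ∷ xs) refl with vecOfLength xs refl
... | v , v≡xs = x Vec.∷ v , cong (x ∷_) v≡xs

edgeVec : (G : Graph n) → edgeCount G ≡ m → Σ[ es ∈ Vec (Fin n × Fin n) m ] EdgeList G (Vec.toList es)
edgeVec G count with vecOfLength (edges G) (trans (length-edges G) count)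
... | es , es≡edges = es , subst (EdgeList G) (sym es≡edges) (edges-edgeList G)

-- Upper bounds

CoversEdges : Graph n → List (Subset n) → Set
CoversEdges G K = ∀ {x y} → x < y → adj G x y ≡ true → Any (λ S → x ∈ₛ S × y ∈ₛ S) K

CoverWithin : Graph n → ℕ → Set
CoverWithin G b = Σ[ k ∈ ℕ ] k ≤ b × HasCliqueCoverOfSize G k

covers-both-ways : (G : Graph n) {K : List (Subset n)} → CoversEdges G K →
  ∀ x y → adj G x y ≡ true → Any (λ S → x ∈ₛ S × y ∈ₛ S) K
covers-both-ways G covers x y xy with Fin.<-cmp x y
... | tri< x<y _ _ = covers x<y xy
... | tri≈ _ refl _ with trans (sym xy) (irrefl G x)
...   | ()
covers-both-ways G covers x y xy | tri> _ _ y<x =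
  Any.map (λ (y∈ , x∈) → x∈ , y∈) (covers y<x (adj-sym G xy))

remove : {w : Fin n} (R : List (Fin n)) → w ∈ R →
  Σ[ R′ ∈ List (Fin n) ] suc (length R′) ≡ length R × (∀ {v} → v ∈ R → v ≡ w ⊎ v ∈ R′)
remove (_ ∷ R) (here refl) = R , refl , λ { (here refl) → inj₁ refl ; (there v∈) → inj₂ v∈ }
remove (x ∷ R) (there w∈) with remove R w∈
... | R′ , size , split = x ∷ R′ , cong suc size , λ
  { (here refl) → inj₂ (here refl)
  ; (there v∈)  → Data.Sum.map₂ there (split v∈) }

complement : (W : List (Fin n)) → Unique W →
  Σ[ R ∈ List (Fin n) ] length W + length R ≡ n × (∀ v → v ∈ W ⊎ v ∈ R)
complement {n} [] [] = allFin n , length-tabulate (λ v → v) , λ v → inj₂ (∈-allFin v)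
complement (w ∷ W) (w∉W ∷ unique) with complement W unique
... | R , size , W∪R with W∪R w
...   | inj₁ w∈W = ⊥-elim (All.All¬⇒¬Any w∉W w∈W)
...   | inj₂ w∈R with remove R w∈R
...     | R′ , size′ , split = R′ , trans (sym (ℕ.+-suc (length W) (length R′))) (trans (cong (length W +_) size′) size) , cover
  where
  cover : ∀ v → v ∈ w ∷ W ⊎ v ∈ R′
  cover v with W∪R v
  ... | inj₁ v∈W = inj₁ (there v∈W)
  ... | inj₂ v∈R with split v∈R
  ...   | inj₁ refl = inj₁ (here refl)
  ...   | inj₂ v∈R′ = inj₂ v∈R′

-- K is completed by the singletons of the vertices outside W.
cover-within : (G : Graph n) (K : List (Subset n)) → All (IsClique G) K → CoversEdges G K →
  (W : List (Fin n)) → Unique W → All (λ w → Any (w ∈ₛ_) K) W →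
  ∀ {d} → length K + d ≤ length W → CoverWithin G (n ∸ d)
cover-within {n} G K cliques covers W unique W⊆K {d} bound with complement W unique
... | R , size , W∪R = length K + length R , ℕ.m+n≤o⇒m≤o∸n _ size-bound , K ++ map ⁅_⁆ R , length-cover ,
  All.++⁺ cliques (All.map⁺ (All.universal (⁅⁆-clique G) R)) , covers-vertices ,
  λ x y xy → Any.++⁺ˡ (covers-both-ways G covers x y xy)
  where
  open ℕ.≤-Reasoning
  size-bound : length K + length R + d ≤ n
  size-bound = begin
    length K + length R + d  ≡⟨ xy∙z≈xz∙y (length K) (length R) d ⟩
    length K + d + length R  ≤⟨ ℕ.+-monoˡ-≤ (length R) bound ⟩
    length W + length R      ≡⟨ size ⟩
    n                        ∎
  length-cover : length (K ++ map ⁅_⁆ R) ≡ length K + length R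
  length-cover = trans (length-++ K) (cong (length K +_) (length-map ⁅_⁆ R))
  covers-vertices : ∀ v → Any (v ∈ₛ_) (K ++ map ⁅_⁆ R)
  covers-vertices v with W∪R v
  ... | inj₁ v∈W = Any.++⁺ˡ (All.lookup W⊆K v∈W)
  ... | inj₂ v∈R = Any.++⁺ʳ K (Any.map⁺ (Any.map (λ { refl → x∈⁅x⁆ v }) v∈R))

grow-cover : (G : Graph n) → Fin n → HasCliqueCoverOfSize G k → ∀ d → HasCliqueCoverOfSize G (k + d)
grow-cover G v (C , refl , cliques , vertices , edges) d =
  C ++ replicate d ⁅ v ⁆ , trans (length-++ C) (cong (length C +_) (length-replicate d)) ,
  All.++⁺ cliques (replicate⁺ d (⁅⁆-clique G v)) , Any.++⁺ˡ ∘ vertices , λ x y xy → Any.++⁺ˡ (edges x y xy)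

endpoints : List (Fin n × Fin n) → List (Fin n)
endpoints []            = []
endpoints ((x , y) ∷ E) = x ∷ y ∷ endpoints E

∈-endpoints : {x y : Fin n} {E : List (Fin n × Fin n)} → (x , y) ∈ E → x ∈ endpoints E × y ∈ endpoints E
∈-endpoints {E = _ ∷ _} (here refl) = here refl , there (here refl)
∈-endpoints {E = _ ∷ _} (there e∈)  = Data.Product.map (there ∘ there) (there ∘ there) (∈-endpoints e∈)

edgeClique : Fin n × Fin n → Subset n
edgeClique (x , y) = fromList (x ∷ y ∷ [])

endpoint-covered : {w : Fin n} (E : List (Fin n × Fin n)) → w ∈ endpoints E → Any (w ∈ₛ_) (map edgeClique E)
endpoint-covered ((x , y) ∷ _) (here refl)         = here (∈-fromList⁺ (x ∷ y ∷ []) (here refl))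
endpoint-covered ((x , y) ∷ _) (there (here refl)) = here (∈-fromList⁺ (x ∷ y ∷ []) (there (here refl)))
endpoint-covered (_ ∷ E)       (there (there w∈))  = there (endpoint-covered E w∈)

-- Covering every edge by its own clique: θ(G) ≤ m + n − |W| whenever the vertices of W are non-isolated.
edge-cover-within : {G : Graph n} {E : List (Fin n × Fin n)} → EdgeList G E →
  (W : List (Fin n)) → Unique W → All (_∈ endpoints E) W →
  ∀ {d} → length E + d ≤ length W → CoverWithin G (n ∸ d)
edge-cover-within {G = G} {E} edgeList W unique W⊆E {d} bound =
  cover-within G (map edgeClique E) cliques covers W unique (All.map (endpoint-covered E) W⊆E)
    (subst (λ l → l + d ≤ length W) (sym (length-map edgeClique E)) bound)
  where
  open EdgeList edgeList using (sound; complete)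
  cliques : All (IsClique G) (map edgeClique E)
  cliques = All.map⁺ (All.tabulate λ { {x , y} e∈ → fromList-clique G ((proj₂ (sound e∈) ∷ []) ∷ [] ∷ []) })
  covers : CoversEdges G (map edgeClique E)
  covers {x} {y} x<y xy = Any.map⁺ (Any.map (λ { refl → ∈-fromList⁺ (x ∷ y ∷ []) (here refl) ,
                                                        ∈-fromList⁺ (x ∷ y ∷ []) (there (here refl)) })
                                            (complete x<y xy))

Joins : Fin n × Fin n → Fin n → Fin n → Set
Joins e u v = e ≡ (u , v) ⊎ e ≡ (v , u)

joins-unique : {x y x′ y′ u v : Fin n} → x < y → x′ < y′ →
  Joins (x , y) u v → Joins (x′ , y′) u v → (x , y) ≡ (x′ , y′)
joins-unique _   _    (inj₁ refl) (inj₁ refl) = refl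
joins-unique x<y x′<y′ (inj₁ refl) (inj₂ refl) = ⊥-elim (Fin.<-asym x<y x′<y′)
joins-unique x<y x′<y′ (inj₂ refl) (inj₁ refl) = ⊥-elim (Fin.<-asym x<y x′<y′)
joins-unique _   _    (inj₂ refl) (inj₂ refl) = refl

adj-joins : (G : Graph n) {x y u v : Fin n} → adj G x y ≡ true → Joins (x , y) u v → adj G u v ≡ true
adj-joins G xy (inj₁ refl) = xy
adj-joins G xy (inj₂ refl) = adj-sym G xy

inside-or-escapes : (T xs : List (Fin n)) → All (_∈ T) xs ⊎ ∃[ d ] d ∈ xs × d ∉ T
inside-or-escapes T xs with all? (λ x → any? (x ≟_) T) xs
... | yes inside = inj₁ inside
... | no ¬inside = inj₂ (find (¬All⇒Any¬ (λ x → any? (x ≟_) T) xs ¬inside))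

ordered-pair-within : {a b x y : Fin n} → a < b → x < y →
  x ∈ a ∷ b ∷ [] → y ∈ a ∷ b ∷ [] → (a , b) ≡ (x , y)
ordered-pair-within _   x<y (here refl)         (here refl)         = ⊥-elim (Fin.<-irrefl refl x<y)
ordered-pair-within _   _   (here refl)         (there (here refl)) = refl
ordered-pair-within a<b x<y (there (here refl)) (here refl)         = ⊥-elim (Fin.<-asym a<b x<y)
ordered-pair-within _   x<y (there (here refl)) (there (here refl)) = ⊥-elim (Fin.<-irrefl refl x<y)

classify : {a b c x y : Fin n} → a < b → x < y → (a , b) ≢ (x , y) →
  x ∈ c ∷ a ∷ b ∷ [] → y ∈ c ∷ a ∷ b ∷ [] → Joins (x , y) c a ⊎ Joins (x , y) c b
classify _   x<y _  (here refl)                 (here refl)                 = ⊥-elim (Fin.<-irrefl refl x<y)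
classify _   _   _  (here refl)                 (there (here refl))         = inj₁ (inj₁ refl)
classify _   _   _  (here refl)                 (there (there (here refl))) = inj₂ (inj₁ refl)
classify _   _   _  (there (here refl))         (here refl)                 = inj₁ (inj₂ refl)
classify _   x<y _  (there (here refl))         (there (here refl))         = ⊥-elim (Fin.<-irrefl refl x<y)
classify _   _   ab≢ (there (here refl))        (there (there (here refl))) = ⊥-elim (ab≢ refl)
classify _   _   _  (there (there (here refl))) (here refl)                 = inj₂ (inj₂ refl)
classify a<b x<y _  (there (there (here refl))) (there (here refl))         = ⊥-elim (Fin.<-asym a<b x<y)
classify _   x<y _  (there (there (here refl))) (there (there (here refl))) = ⊥-elim (Fin.<-irrefl refl x<y)

module _ {G : Graph n} where

  open EdgeList

  ordered : {E : List (Fin n × Fin n)} {x y : Fin n} → EdgeList G E → (x , y) ∈ E → x < y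
  ordered edgeList = proj₁ ∘ sound edgeList

  three-vertices : {a b x y : Fin n} {E : List (Fin n × Fin n)} → EdgeList G ((a , b) ∷ (x , y) ∷ E) →
    ∃[ c ] Unique (c ∷ a ∷ b ∷ []) × All (_∈ endpoints ((a , b) ∷ (x , y) ∷ E)) (c ∷ a ∷ b ∷ [])
  three-vertices {a = a} {b} {x} {y} edgeList with inside-or-escapes (a ∷ b ∷ []) (x ∷ y ∷ []) | unique edgeList
  ... | inj₁ (x∈ ∷ y∈ ∷ []) | (ab≢xy ∷ _) ∷ _ =
    ⊥-elim (ab≢xy (ordered-pair-within (ordered edgeList (here refl)) (ordered edgeList (there (here refl))) x∈ y∈))
  ... | inj₂ (c , c∈xy , c∉ab) | _ =
    c , (¬Any⇒All¬ _ c∉ab ∷ (Fin.<⇒≢ (ordered edgeList (here refl)) ∷ []) ∷ [] ∷ []) ,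
    there (there (∈-++⁺ˡ c∈xy)) ∷ here refl ∷ there (here refl) ∷ []

  remaining-sides : {a b c x₂ y₂ x₃ y₃ : Fin n} {E : List (Fin n × Fin n)} →
    EdgeList G ((a , b) ∷ (x₂ , y₂) ∷ (x₃ , y₃) ∷ E) →
    All (_∈ c ∷ a ∷ b ∷ []) (x₂ ∷ y₂ ∷ x₃ ∷ y₃ ∷ []) →
    Joins (x₂ , y₂) c a × Joins (x₃ , y₃) c b ⊎ Joins (x₂ , y₂) c b × Joins (x₃ , y₃) c a
  remaining-sides {a = a} {b} {c} {x₂} {y₂} {x₃} {y₃} edgeList (x₂∈ ∷ y₂∈ ∷ x₃∈ ∷ y₃∈ ∷ []) with unique edgeList
  ... | (ab≢e₂ ∷ ab≢e₃ ∷ _) ∷ (e₂≢e₃ ∷ _) ∷ _ =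
    sides (classify a<b x₂<y₂ ab≢e₂ x₂∈ y₂∈) (classify a<b x₃<y₃ ab≢e₃ x₃∈ y₃∈)
    where
    a<b : a < b
    a<b = ordered edgeList (here refl)
    x₂<y₂ : x₂ < y₂
    x₂<y₂ = ordered edgeList (there (here refl))
    x₃<y₃ : x₃ < y₃
    x₃<y₃ = ordered edgeList (there (there (here refl)))
    sides : Joins (x₂ , y₂) c a ⊎ Joins (x₂ , y₂) c b → Joins (x₃ , y₃) c a ⊎ Joins (x₃ , y₃) c b →
      Joins (x₂ , y₂) c a × Joins (x₃ , y₃) c b ⊎ Joins (x₂ , y₂) c b × Joins (x₃ , y₃) c a
    sides (inj₁ j₂) (inj₂ j₃) = inj₁ (j₂ , j₃)
    sides (inj₂ j₂) (inj₁ j₃) = inj₂ (j₂ , j₃)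
    sides (inj₁ j₂) (inj₁ j₃) = ⊥-elim (e₂≢e₃ (joins-unique x₂<y₂ x₃<y₃ j₂ j₃))
    sides (inj₂ j₂) (inj₂ j₃) = ⊥-elim (e₂≢e₃ (joins-unique x₂<y₂ x₃<y₃ j₂ j₃))

  inside-covered : {E : List (Fin n × Fin n)} (T : List (Fin n)) → EdgeList G E →
    All (_∈ T) (endpoints E) → CoversEdges G (fromList T ∷ [])
  inside-covered T edgeList inside x<y xy with ∈-endpoints (complete edgeList x<y xy)
  ... | x∈ , y∈ = here (∈-fromList⁺ T (All.lookup inside x∈) , ∈-fromList⁺ T (All.lookup inside y∈))

  within-no-edges : EdgeList G [] → CoverWithin G n
  within-no-edges edgeList = edge-cover-within edgeList [] [] [] z≤n

  within-one-edge : {a b : Fin n} → EdgeList G ((a , b) ∷ []) → CoverWithin G (n ∸ 1)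
  within-one-edge {a = a} {b} edgeList = edge-cover-within edgeList (a ∷ b ∷ [])
    ((Fin.<⇒≢ (ordered edgeList (here refl)) ∷ []) ∷ [] ∷ []) (here refl ∷ there (here refl) ∷ []) ℕ.≤-refl

  within-two-edges : {a b x y : Fin n} → EdgeList G ((a , b) ∷ (x , y) ∷ []) → CoverWithin G (n ∸ 1)
  within-two-edges {a = a} {b} edgeList with three-vertices edgeList
  ... | c , uniqueT , T⊆E = edge-cover-within edgeList (c ∷ a ∷ b ∷ []) uniqueT T⊆E ℕ.≤-refl

  -- If all edges lie in a clique T, one clique covers them: θ(G) ≤ 1 + n − |T|.
  clique-cover-within : {E : List (Fin n × Fin n)} (T : List (Fin n)) → EdgeList G E → Unique T →
    AllPairs (λ x y → adj G x y ≡ true) T → All (_∈ T) (endpoints E) →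
    ∀ {d} → 1 + d ≤ length T → CoverWithin G (n ∸ d)
  clique-cover-within T edgeList uniqueT clique inside =
    cover-within G (fromList T ∷ []) (fromList-clique G clique ∷ []) (inside-covered T edgeList inside)
      T uniqueT (All.tabulate (here ∘ ∈-fromList⁺ T))

  -- Either a fourth vertex is touched, or the three edges form a triangle.
  within-three-edges : {a b x₂ y₂ x₃ y₃ : Fin n} →
    EdgeList G ((a , b) ∷ (x₂ , y₂) ∷ (x₃ , y₃) ∷ []) → CoverWithin G (n ∸ 1)
  within-three-edges {a = a} {b} {x₂} {y₂} {x₃} {y₃} edgeList with three-vertices edgeList
  ... | c , uniqueT , T⊆E with inside-or-escapes (c ∷ a ∷ b ∷ []) (a ∷ b ∷ x₂ ∷ y₂ ∷ x₃ ∷ y₃ ∷ [])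
  ...   | inj₂ (d , d∈E , d∉T) =
    edge-cover-within edgeList (d ∷ c ∷ a ∷ b ∷ []) (¬Any⇒All¬ _ d∉T ∷ uniqueT) (d∈E ∷ T⊆E) ℕ.≤-refl
  ...   | inj₁ inside = clique-cover-within (c ∷ a ∷ b ∷ []) edgeList uniqueT
    (triangle (remaining-sides edgeList (All.tail (All.tail inside)))) inside (s≤s (s≤s z≤n))
    where
    ab : adj G a b ≡ true
    ab = proj₂ (sound edgeList (here refl))
    xy₂ : adj G x₂ y₂ ≡ true
    xy₂ = proj₂ (sound edgeList (there (here refl)))
    xy₃ : adj G x₃ y₃ ≡ true
    xy₃ = proj₂ (sound edgeList (there (there (here refl))))
    triangle : Joins (x₂ , y₂) c a × Joins (x₃ , y₃) c b ⊎ Joins (x₂ , y₂) c b × Joins (x₃ , y₃) c a →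
      AllPairs (λ x y → adj G x y ≡ true) (c ∷ a ∷ b ∷ [])
    triangle (inj₁ (j₂ , j₃)) = (adj-joins G xy₂ j₂ ∷ adj-joins G xy₃ j₃ ∷ []) ∷ (ab ∷ []) ∷ [] ∷ []
    triangle (inj₂ (j₂ , j₃)) = (adj-joins G xy₃ j₃ ∷ adj-joins G xy₂ j₂ ∷ []) ∷ (ab ∷ []) ∷ [] ∷ []

  -- Three edges besides ab cannot all lie inside {c, a, b}, so a fourth vertex is touched.
  within-four-edges : {a b x₂ y₂ x₃ y₃ x₄ y₄ : Fin n} →
    EdgeList G ((a , b) ∷ (x₂ , y₂) ∷ (x₃ , y₃) ∷ (x₄ , y₄) ∷ []) → CoverWithin G n
  within-four-edges {a = a} {b} {x₂} {y₂} {x₃} {y₃} {x₄} {y₄} edgeList with three-vertices edgeList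
  ... | c , uniqueT , T⊆E with inside-or-escapes (c ∷ a ∷ b ∷ []) (a ∷ b ∷ x₂ ∷ y₂ ∷ x₃ ∷ y₃ ∷ x₄ ∷ y₄ ∷ [])
  ...   | inj₂ (d , d∈E , d∉T) =
    edge-cover-within edgeList (d ∷ c ∷ a ∷ b ∷ []) (¬Any⇒All¬ _ d∉T ∷ uniqueT) (d∈E ∷ T⊆E) ℕ.≤-refl
  ...   | inj₁ (_ ∷ _ ∷ x₂∈ ∷ y₂∈ ∷ x₃∈ ∷ y₃∈ ∷ x₄∈ ∷ y₄∈ ∷ []) with unique edgeList
  ...     | (_ ∷ _ ∷ ab≢e₄ ∷ []) ∷ (_ ∷ e₂≢e₄ ∷ []) ∷ (e₃≢e₄ ∷ []) ∷ [] ∷ [] =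
    ⊥-elim (pigeonhole (remaining-sides edgeList (x₂∈ ∷ y₂∈ ∷ x₃∈ ∷ y₃∈ ∷ []))
                       (classify (ordered edgeList (here refl)) x₄<y₄ ab≢e₄ x₄∈ y₄∈))
    where
    x₂<y₂ : x₂ < y₂
    x₂<y₂ = ordered edgeList (there (here refl))
    x₃<y₃ : x₃ < y₃
    x₃<y₃ = ordered edgeList (there (there (here refl)))
    x₄<y₄ : x₄ < y₄
    x₄<y₄ = ordered edgeList (there (there (there (here refl))))
    pigeonhole : Joins (x₂ , y₂) c a × Joins (x₃ , y₃) c b ⊎ Joins (x₂ , y₂) c b × Joins (x₃ , y₃) c a →
      Joins (x₄ , y₄) c a ⊎ Joins (x₄ , y₄) c b → ⊥
    pigeonhole (inj₁ (j₂ , _)) (inj₁ j₄) = e₂≢e₄ (joins-unique x₂<y₂ x₄<y₄ j₂ j₄)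
    pigeonhole (inj₁ (_ , j₃)) (inj₂ j₄) = e₃≢e₄ (joins-unique x₃<y₃ x₄<y₄ j₃ j₄)
    pigeonhole (inj₂ (_ , j₃)) (inj₁ j₄) = e₃≢e₄ (joins-unique x₃<y₃ x₄<y₄ j₃ j₄)
    pigeonhole (inj₂ (j₂ , _)) (inj₂ j₄) = e₂≢e₄ (joins-unique x₂<y₂ x₄<y₄ j₂ j₄)

edgeCount≡0⇒coverWithin : (G : Graph n) → edgeCount G ≡ 0 → CoverWithin G n
edgeCount≡0⇒coverWithin G count with edgeVec G count
... | Vec.[] , edgeList = within-no-edges edgeList

edgeCount≡1⇒coverWithin : (G : Graph n) → edgeCount G ≡ 1 → CoverWithin G (n ∸ 1)
edgeCount≡1⇒coverWithin G count with edgeVec G count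
... | _ Vec.∷ Vec.[] , edgeList = within-one-edge edgeList

edgeCount≡2⇒coverWithin : (G : Graph n) → edgeCount G ≡ 2 → CoverWithin G (n ∸ 1)
edgeCount≡2⇒coverWithin G count with edgeVec G count
... | _ Vec.∷ _ Vec.∷ Vec.[] , edgeList = within-two-edges edgeList

edgeCount≡3⇒coverWithin : (G : Graph n) → edgeCount G ≡ 3 → CoverWithin G (n ∸ 1)
edgeCount≡3⇒coverWithin G count with edgeVec G count
... | _ Vec.∷ _ Vec.∷ _ Vec.∷ Vec.[] , edgeList = within-three-edges edgeList

edgeCount≡4⇒coverWithin : (G : Graph n) → edgeCount G ≡ 4 → CoverWithin G n
edgeCount≡4⇒coverWithin G count with edgeVec G count
... | _ Vec.∷ _ Vec.∷ _ Vec.∷ _ Vec.∷ Vec.[] , edgeList = within-four-edges edgeList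

-- Lower bounds

-- Pairs that are vertices or edges, no two of which fit in one clique, need distinct cliques.
separated-pairs-≤ : (G : Graph n) (p q : Fin k → Fin n) →
  (∀ u → p u ≡ q u ⊎ adj G (p u) (q u) ≡ true) →
  (∀ {u w} → u ≢ w → ∀ {S} → IsClique G S → p u ∈ₛ S → q u ∈ₛ S → p w ∈ₛ S → q w ∈ₛ S → ⊥) →
  ∀ {k′} → HasCliqueCoverOfSize G k′ → k ≤ k′
separated-pairs-≤ G p q present separated (C , refl , cliques , vertices , edges) = Fin.injective⇒≤ injective
  where
  covering : ∀ u → Any (λ S → p u ∈ₛ S × q u ∈ₛ S) C
  covering u with present u
  ... | inj₁ pu≡qu = Any.map (λ pu∈ → pu∈ , subst (_∈ₛ _) pu≡qu pu∈) (vertices (p u))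
  ... | inj₂ pq    = edges (p u) (q u) pq
  injective : ∀ {u w} → index (covering u) ≡ index (covering w) → u ≡ w
  injective {u} {w} same with u ≟ w | All.lookupAny cliques (covering u) | All.lookupAny cliques (covering w)
  ... | yes u≡w | _                       | _                 = u≡w
  ... | no u≢w  | clique , (pu∈ , qu∈)    | _ , (pw∈ , qw∈)   = ⊥-elim (separated u≢w clique pu∈ qu∈
      (subst (λ i → p w ∈ₛ lookup C i) (sym same) pw∈) (subst (λ i → q w ∈ₛ lookup C i) (sym same) qw∈))

independent-≤ : (G : Graph n) (f : Fin k → Fin n) →
  (∀ {u w} → u ≢ w → f u ≢ f w × adj G (f u) (f w) ≡ false) →
  ∀ {k′} → HasCliqueCoverOfSize G k′ → k ≤ k′
independent-≤ G f independent = separated-pairs-≤ G f f (λ _ → inj₁ refl)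
  λ u≢w clique fu∈ _ fw∈ _ → clique-nonadjacent G clique fu∈ fw∈ (proj₁ (independent u≢w)) (proj₂ (independent u≢w))

-- The extremal graphs

sum-map-0 : {A : Set} {f : A → ℕ} → (∀ x → f x ≡ 0) → (xs : List A) → sum (map f xs) ≡ 0
sum-map-0 vanish []       = refl
sum-map-0 vanish (x ∷ xs) = cong₂ _+_ (vanish x) (sum-map-0 vanish xs)

sum-tabulate-↑ˡ : ∀ m (f : Fin (m + j) → ℕ) → (∀ x → f (m ↑ʳ x) ≡ 0) →
  sum (tabulate f) ≡ sum (tabulate (f ∘ (_↑ˡ j)))
sum-tabulate-↑ˡ zero    f vanish = trans (cong sum (sym (map-tabulate (λ x → x) f))) (sum-map-0 vanish (allFin _))
sum-tabulate-↑ˡ (suc m) f vanish = cong (f zero +_) (sum-tabulate-↑ˡ m (f ∘ suc) vanish)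

sum-allFin-↑ˡ : ∀ m (f : Fin (m + j) → ℕ) → (∀ x → f (m ↑ʳ x) ≡ 0) →
  sum (map f (allFin (m + j))) ≡ sum (map (f ∘ (_↑ˡ j)) (allFin m))
sum-allFin-↑ˡ {j} m f vanish = begin
  sum (map f (allFin (m + j)))         ≡⟨ cong sum (map-tabulate (λ x → x) f) ⟩
  sum (tabulate f)                     ≡⟨ sum-tabulate-↑ˡ m f vanish ⟩
  sum (tabulate (f ∘ (_↑ˡ j)))         ≡⟨ cong sum (map-tabulate (λ x → x) (f ∘ (_↑ˡ j))) ⟨
  sum (map (f ∘ (_↑ˡ j)) (allFin m))   ∎
  where open ≡-Reasoning

restrict : Graph (m + j) → Graph m
restrict {j = j} G = record
  { adj    = λ x y → adj G (x ↑ˡ j) (y ↑ˡ j)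
  ; sym    = λ x y → Graph.sym G (x ↑ˡ j) (y ↑ˡ j)
  ; irrefl = λ x → irrefl G (x ↑ˡ j)
  }

edgeCount-restrict : (G : Graph (m + j)) → (∀ x y → adj G (m ↑ʳ x) y ≡ false) →
  edgeCount G ≡ edgeCount (restrict {m} {j} G)
edgeCount-restrict {m} {j} G isolated = begin
  sum (map row (allFin (m + j)))
    ≡⟨ sum-allFin-↑ˡ m row (λ x → sum-map-0 (entry-0 ∘ isolated x) (allFin (m + j))) ⟩
  sum (map (row ∘ (_↑ˡ j)) (allFin m))
    ≡⟨ cong sum (map-cong restricted-row (allFin m)) ⟩
  edgeCount (restrict {m} {j} G)
    ∎
  where
  open ≡-Reasoning
  entry : Fin (m + j) → Fin (m + j) → ℕ
  entry x y = if (toℕ x <ᵇ toℕ y) ∧ adj G x y then 1 else 0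
  row : Fin (m + j) → ℕ
  row x = sum (map (entry x) (allFin (m + j)))
  entry-0 : ∀ {x y} → adj G x y ≡ false → entry x y ≡ 0
  entry-0 xy = cong (λ b → if b then 1 else 0) (trans (cong (_ ∧_) xy) (∧-zeroʳ _))
  entryʳ : Fin m → Fin m → ℕ
  entryʳ x y = if (toℕ x <ᵇ toℕ y) ∧ adj (restrict {m} {j} G) x y then 1 else 0
  restricted-entry : ∀ x y → entry (x ↑ˡ j) (y ↑ˡ j) ≡ entryʳ x y
  restricted-entry x y =
    cong₂ (λ a b → if (a <ᵇ b) ∧ adj G (x ↑ˡ j) (y ↑ˡ j) then 1 else 0) (Fin.toℕ-↑ˡ x j) (Fin.toℕ-↑ˡ y j)
  restricted-row : ∀ x → row (x ↑ˡ j) ≡ sum (map (entryʳ x) (allFin m))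
  restricted-row x = begin
    row (x ↑ˡ j)
      ≡⟨ sum-allFin-↑ˡ m (entry (x ↑ˡ j)) (λ y → entry-0 (trans (Graph.sym G _ _) (isolated y _))) ⟩
    sum (map (entry (x ↑ˡ j) ∘ (_↑ˡ j)) (allFin m))
      ≡⟨ cong sum (map-cong (restricted-entry x) (allFin m)) ⟩
    sum (map (entryʳ x) (allFin m))
      ∎

undirected : (R : ℕ → ℕ → Bool) → (∀ a → R a a ≡ false) → Graph n
undirected R loopless = record
  { adj    = λ x y → R (toℕ x) (toℕ y) ∨ R (toℕ y) (toℕ x)
  ; sym    = λ x y → ∨-comm (R (toℕ x) (toℕ y)) (R (toℕ y) (toℕ x))
  ; irrefl = λ x → cong₂ _∨_ (loopless (toℕ x)) (loopless (toℕ x))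
  }

undirected-isolated : ∀ m (R : ℕ → ℕ → Bool) (loopless : ∀ a → R a a ≡ false) →
  (∀ a b → R (m + a) b ≡ false) → (∀ a b → R b (m + a) ≡ false) →
  ∀ x y → adj (undirected {m + j} R loopless) (m ↑ʳ x) y ≡ false
undirected-isolated m R _ after before x y rewrite Fin.toℕ-↑ʳ m x = cong₂ _∨_ (after _ _) (before _ _)

edgeless : Graph n
edgeless = undirected (λ _ _ → false) (λ _ → refl)

starRel : ℕ → ℕ → ℕ → Bool
starRel l zero (suc b) = b <ᵇ l
starRel l _    _       = false

starRel-loopless : ∀ l a → starRel l a a ≡ false
starRel-loopless l zero    = refl
starRel-loopless l (suc a) = refl

-- the star K₁,ₗ with centre 0 and leaves 1, …, l
star : ℕ → Graph n
star l = undirected (starRel l) (starRel-loopless l)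

cycleRel : ℕ → ℕ → Bool
cycleRel 0 1 = true
cycleRel 1 2 = true
cycleRel 2 3 = true
cycleRel 0 3 = true
cycleRel _ _ = false

cycleRel-loopless : ∀ a → cycleRel a a ≡ false
cycleRel-loopless 0                   = refl
cycleRel-loopless 1                   = refl
cycleRel-loopless 2                   = refl
cycleRel-loopless (suc (suc (suc a))) = refl

cycle₄ : Graph n
cycle₄ = undirected cycleRel cycleRel-loopless

<ᵇ-false : {a l b : ℕ} → l ≤ b → (b + a <ᵇ l) ≡ false
<ᵇ-false z≤n       = refl
<ᵇ-false (s≤s l≤b) = <ᵇ-false l≤b

edgeCount-edgeless : edgeCount (edgeless {4 + j}) ≡ 0
edgeCount-edgeless {j} = edgeCount-restrict {4} {j} edgeless (undirected-isolated 4 (λ _ _ → false) (λ _ → refl) (λ _ _ → refl) (λ _ _ → refl))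

edgeCount-star : ∀ l → l ≤ 3 → edgeCount (star {4 + j} l) ≡ l
edgeCount-star {j} l l≤3 = trans (edgeCount-restrict {4} {j} (star l) (undirected-isolated 4 (starRel l) (starRel-loopless l) (λ _ _ → refl) before)) (restricted l≤3)
  where
  restricted : ∀ {l} → l ≤ 3 → edgeCount (restrict {4} {j} (star l)) ≡ l
  restricted z≤n                   = refl
  restricted (s≤s z≤n)             = refl
  restricted (s≤s (s≤s z≤n))       = refl
  restricted (s≤s (s≤s (s≤s z≤n))) = refl
  before : ∀ a b → starRel l b (4 + a) ≡ false
  before a zero    = <ᵇ-false l≤3
  before a (suc b) = refl

edgeCount-cycle₄ : edgeCount (cycle₄ {4 + j}) ≡ 4
edgeCount-cycle₄ {j} = edgeCount-restrict {4} {j} cycle₄ (undirected-isolated 4 cycleRel cycleRel-loopless (λ _ _ → refl) before)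
  where
  before : ∀ a b → cycleRel b (4 + a) ≡ false
  before a 0 = refl
  before a 1 = refl
  before a 2 = refl
  before a (suc (suc (suc b))) = refl

edgeless-≤ : ∀ {k} → HasCliqueCoverOfSize (edgeless {n}) k → n ≤ k
edgeless-≤ = independent-≤ edgeless (λ x → x) (λ u≢w → u≢w , refl)

-- the leaves and the isolated vertices are independent
star-≤ : ∀ l {k} → HasCliqueCoverOfSize (star {suc n} l) k → n ≤ k
star-≤ l = independent-≤ (star l) suc (λ u≢w → u≢w ∘ Fin.suc-injective , refl)

pattern v₀ = zero
pattern v₁ = suc v₀
pattern v₂ = suc v₁
pattern v₃ = suc v₂
pattern v₄₊ x = suc (suc (suc (suc x)))

next : Fin (4 + j) → Fin (4 + j)
next v₀      = v₁
next v₁      = v₂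
next v₂      = v₃
next v₃      = v₀
next (v₄₊ x) = v₄₊ x

-- the four edges of the cycle and the isolated vertices
cycle₄-≤ : ∀ {k} → HasCliqueCoverOfSize (cycle₄ {4 + j}) k → 4 + j ≤ k
cycle₄-≤ {j} = separated-pairs-≤ cycle₄ (λ x → x) next present (λ {u} {w} → separated u w)
  where
  isolated : ∀ x y → adj (cycle₄ {4 + j}) (v₄₊ x) y ≡ false
  isolated = undirected-isolated 4 cycleRel cycleRel-loopless (λ _ _ → refl)
    λ { a 0 → refl ; a 1 → refl ; a 2 → refl ; a (suc (suc (suc b))) → refl }
  present : ∀ u → u ≡ next u ⊎ adj cycle₄ u (next u) ≡ true
  present v₀      = inj₂ refl
  present v₁      = inj₂ refl
  present v₂      = inj₂ refl
  present v₃      = inj₂ refl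
  present (v₄₊ x) = inj₁ refl
  apart : ∀ {S x y} → IsClique cycle₄ S → x ∈ₛ S → y ∈ₛ S → x ≢ y → adj cycle₄ x y ≡ false → ⊥
  apart = clique-nonadjacent cycle₄
  -- in each case two of u, next u, w, next w are distinct and non-adjacent
  separated : ∀ u w → u ≢ w → ∀ {S} → IsClique cycle₄ S → u ∈ₛ S → next u ∈ₛ S → w ∈ₛ S → next w ∈ₛ S → ⊥
  separated v₀ v₀ u≢w _ _  _   _  _   = u≢w refl
  separated v₀ v₁ _   c u∈ _   _  nw∈ = apart c u∈ nw∈ (λ ()) refl
  separated v₀ v₂ _   c u∈ _   w∈ _   = apart c u∈ w∈ (λ ()) refl
  separated v₀ v₃ _   c _  nu∈ w∈ _   = apart c nu∈ w∈ (λ ()) refl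
  separated v₁ v₀ _   c _  nu∈ w∈ _   = apart c nu∈ w∈ (λ ()) refl
  separated v₁ v₁ u≢w _ _  _   _  _   = u≢w refl
  separated v₁ v₂ _   c u∈ _   _  nw∈ = apart c u∈ nw∈ (λ ()) refl
  separated v₁ v₃ _   c u∈ _   w∈ _   = apart c u∈ w∈ (λ ()) refl
  separated v₂ v₀ _   c u∈ _   w∈ _   = apart c u∈ w∈ (λ ()) refl
  separated v₂ v₁ _   c _  nu∈ w∈ _   = apart c nu∈ w∈ (λ ()) refl
  separated v₂ v₂ u≢w _ _  _   _  _   = u≢w refl
  separated v₂ v₃ _   c u∈ _   _  nw∈ = apart c u∈ nw∈ (λ ()) refl
  separated v₃ v₀ _   c u∈ _   _  nw∈ = apart c u∈ nw∈ (λ ()) refl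
  separated v₃ v₁ _   c u∈ _   w∈ _   = apart c u∈ w∈ (λ ()) refl
  separated v₃ v₂ _   c _  nu∈ w∈ _   = apart c nu∈ w∈ (λ ()) refl
  separated v₃ v₃ u≢w _ _  _   _  _   = u≢w refl
  separated (v₄₊ x) w       u≢w c u∈ _ w∈ _ = apart c u∈ w∈ u≢w (isolated x w)
  separated u       (v₄₊ y) u≢w c u∈ _ w∈ _ = apart c w∈ u∈ (u≢w ∘ sym) (isolated y u)

extremal : Fin n → (H : Graph n) → edgeCount H ≡ m → (∀ {k} → HasCliqueCoverOfSize H k → b ≤ k) →
  (∀ (G : Graph n) → edgeCount G ≡ m → CoverWithin G b) → BigThetaIs n m b
extremal v H count lower upper with upper H count
... | k , k≤b , cover =
  (H , count , subst (HasCliqueCoverOfSize H) (ℕ.m+[n∸m]≡n k≤b) (grow-cover H v cover (_ ∸ k)) , λ _ → lower) ,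
  λ G k′ count′ (_ , minimal) → let (_ , k≤b , cover) = upper G count′ in ℕ.≤-trans (minimal _ cover) k≤b

claim3 : ∀ (n : ℕ) → 4 ≤ n →
    BigThetaIs n 0 n × BigThetaIs n 4 n
    × BigThetaIs n 1 (n ∸ 1) × BigThetaIs n 2 (n ∸ 1) × BigThetaIs n 3 (n ∸ 1)
claim3 (suc (suc (suc (suc j)))) (s≤s (s≤s (s≤s (s≤s _)))) =
    extremal zero edgeless (edgeCount-edgeless {j}) edgeless-≤ edgeCount≡0⇒coverWithin
  , extremal zero cycle₄ (edgeCount-cycle₄ {j}) cycle₄-≤ edgeCount≡4⇒coverWithin
  , extremal zero (star 1) (edgeCount-star {j} 1 (s≤s z≤n)) (star-≤ 1) edgeCount≡1⇒coverWithin
  , extremal zero (star 2) (edgeCount-star {j} 2 (s≤s (s≤s z≤n))) (star-≤ 2) edgeCount≡2⇒coverWithin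
  , extremal zero (star 3) (edgeCount-star {j} 3 (s≤s (s≤s (s≤s z≤n)))) (star-≤ 3) edgeCount≡3⇒coverWithin
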